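{- Let $i$ be a positive integer, let $D$ be an $\langle i,2\rangle$ digraph and let $G$ be its competition graph. Then $G$ is chordal if and only if $D$ has no subdigraph $D'$ which is a $\langle\bar 2,\bar 2\rangle$ digraph such that (i) $D'$ is irredundant, (ii) $D'$ does not induce a triangle, and (iii) $D'$ has at least one arc.
   Context: All digraphs are finite, without loops and without parallel arcs; all graphs are finite and simple. The competition graph of a digraph $D$ has vertex set $V(D)$ and an edge $uv$ ($u\ne v$) iff $u$ and $v$ have a common out-neighbor in $D$. For positive integers $i,j$, an $\langle i,j\rangle$ digraph is a loopless digraph in which every vertex has indegree at most $i$ and outdegree at most $j$ (not necessarily acyclic). A $\langle\bar 2,\bar 2\rangle$ digraph is a loopless digraph in which every vertex has indegree $0$ or $2$ and outdegree $0$ or $2$. A digraph is irredundant if it has no (not necessarily induced) subdigraph isomorphic to $P(2,2)$, the digraph on four distinct vertices $u,v,x,y$ with arcs $(u,x),(u,y),(v,x),(v,y)$. A digraph $D$ induces a triangle if it has a (not necessarily induced) subdigraph isomorphic to one of the following five digraphs: (a) vertices $u_1,u_2,u_3,v_1,v_2,v_3$ with arcs $(u_1,v_1),(u_1,v_3),(u_2,v_1),(u_2,v_2),(u_3,v_2),(u_3,v_3)$; (b) vertices $u_1,u_2,u_3,v_1$ with arcs $(u_1,v_1),(u_2,v_1),(u_3,v_1)$; (c) vertices $u_1,u_2,u_3,v_1,v_3$ with arcs $(u_1,v_1),(u_1,u_2),(u_2,v_1),(u_2,v_3),(u_3,u_2),(u_3,v_3)$; (d) vertices $u_1,u_2,u_3$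 with all six arcs $(u_a,u_b)$, $a\ne b$; (e) vertices $u_1,u_2,v_1,v_2$ with arcs $(u_1,u_2),(u_2,u_1),(u_1,v_1),(u_2,v_1),(v_2,u_1),(v_2,u_2)$. A graph is chordal if it has no induced cycle of length at least $4$. -}

module Defs where

open import Data.Nat using (ℕ; zero; suc; _≤_; _+_)
open import Data.Fin using (Fin; toℕ; #_)
open import Data.List.Relation.Unary.All using (All; []; _∷_)
open import Data.Bool using (Bool; true; false; _∧_)
open import Data.List using (List; []; _∷_; length; filterᵇ; allFin)
open import Data.Product using (Σ; ∃; _×_; _,_)
open import Data.Sum using (_⊎_)
open import Relation.Binary.PropositionalEquality using (_≡_; _≢_)
open import Relation.Nullary using (¬_)
open import Function.Bundles using (_⇔_)
open import Function.Definitions using (Injective)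

-- A digraph on vertex set Fin n, given by its arc relation (adjacency matrix).
-- Loops are excluded separately by 'Loopless'; parallel arcs cannot occur.
Digraph : ℕ → Set
Digraph n = Fin n → Fin n → Bool

Loopless : ∀ {n} → Digraph n → Set
Loopless {n} A = (v : Fin n) → A v v ≡ false

countᵇ : ∀ {n} → (Fin n → Bool) → ℕ
countᵇ {n} p = length (filterᵇ p (allFin n))

indeg : ∀ {n} → Digraph n → Fin n → ℕ
indeg A v = countᵇ (λ u → A u v)

outdeg : ∀ {n} → Digraph n → Fin n → ℕ
outdeg A v = countᵇ (λ w → A v w)

IJDigraph : ℕ → ℕ → ∀ {n} → Digraph n → Set
IJDigraph i j {n} A = Loopless A × ((v : Fin n) → indeg A v ≤ i × outdeg A v ≤ j)

record Subdigraph {n} (A : Digraph n) : Set where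
  field
    verts : Fin n → Bool
    arcs  : Fin n → Fin n → Bool
    arcs⊆ : ∀ u v → arcs u v ≡ true → A u v ≡ true
    tail∈ : ∀ u v → arcs u v ≡ true → verts u ≡ true
    head∈ : ∀ u v → arcs u v ≡ true → verts v ≡ true
open Subdigraph public

sub-indeg : ∀ {n} {A : Digraph n} → Subdigraph A → Fin n → ℕ
sub-indeg D' v = indeg (arcs D') v

sub-outdeg : ∀ {n} {A : Digraph n} → Subdigraph A → Fin n → ℕ
sub-outdeg D' v = outdeg (arcs D') v

ZeroOrTwo : ℕ → Set
ZeroOrTwo d = d ≡ 0 ⊎ d ≡ 2

-- ⟨2̄,2̄⟩ (looplessness is inherited from the ambient digraph)
Is22bar : ∀ {n} {A : Digraph n} → Subdigraph A → Set
Is22bar {n} D' = (v : Fin n) → verts D' v ≡ true →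
  ZeroOrTwo (sub-indeg D' v) × ZeroOrTwo (sub-outdeg D' v)

HasArc : ∀ {n} {A : Digraph n} → Subdigraph A → Set
HasArc D' = ∃ λ u → ∃ λ v → arcs D' u v ≡ true

-- A subdigraph D'
-- has a (not necessarily induced) subdigraph isomorphic to the pattern iff
-- there is an injective vertex map into the vertices of D' sending arcs to arcs.

ContainsPattern : ∀ {n} {A : Digraph n} → Subdigraph A →
                  (k : ℕ) → List (Fin k × Fin k) → Set
ContainsPattern {n} D' k pat =
  Σ (Fin k → Fin n) λ f →
    Injective _≡_ _≡_ f ×
    ((x : Fin k) → verts D' (f x) ≡ true) ×
    All (λ { (a , b) → arcs D' (f a) (f b) ≡ true }) pat

-- P(2,2): u=0, v=1, x=2, y=3
P22 : List (Fin 4 × Fin 4)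
P22 = (# 0 , # 2) ∷ (# 0 , # 3) ∷ (# 1 , # 2) ∷ (# 1 , # 3) ∷ []

Irredundant : ∀ {n} {A : Digraph n} → Subdigraph A → Set
Irredundant D' = ¬ ContainsPattern D' 4 P22

-- (a) u1=0,u2=1,u3=2,v1=3,v2=4,v3=5
triA : List (Fin 6 × Fin 6)
triA = (# 0 , # 3) ∷ (# 0 , # 5) ∷ (# 1 , # 3) ∷ (# 1 , # 4) ∷ (# 2 , # 4) ∷ (# 2 , # 5) ∷ []

-- (b) u1=0,u2=1,u3=2,v1=3
triB : List (Fin 4 × Fin 4)
triB = (# 0 , # 3) ∷ (# 1 , # 3) ∷ (# 2 , # 3) ∷ []

-- (c) u1=0,u2=1,u3=2,v1=3,v3=4
triC : List (Fin 5 × Fin 5)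
triC = (# 0 , # 3) ∷ (# 0 , # 1) ∷ (# 1 , # 3) ∷ (# 1 , # 4) ∷ (# 2 , # 1) ∷ (# 2 , # 4) ∷ []

-- (d) u1=0,u2=1,u3=2
triD : List (Fin 3 × Fin 3)
triD = (# 0 , # 1) ∷ (# 0 , # 2) ∷ (# 1 , # 0) ∷ (# 1 , # 2) ∷ (# 2 , # 0) ∷ (# 2 , # 1) ∷ []

-- (e) u1=0,u2=1,v1=2,v2=3
triE : List (Fin 4 × Fin 4)
triE = (# 0 , # 1) ∷ (# 1 , # 0) ∷ (# 0 , # 2) ∷ (# 1 , # 2) ∷ (# 3 , # 0) ∷ (# 3 , # 1) ∷ []

InducesTriangle : ∀ {n} {A : Digraph n} → Subdigraph A → Set
InducesTriangle D' =
  ContainsPattern D' 6 triA ⊎ ContainsPattern D' 4 triB ⊎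
  ContainsPattern D' 5 triC ⊎ ContainsPattern D' 3 triD ⊎
  ContainsPattern D' 4 triE

CompEdge : ∀ {n} → Digraph n → Fin n → Fin n → Set
CompEdge A u v = u ≢ v × ∃ λ w → A u w ≡ true × A v w ≡ true

CycAdj : (m : ℕ) → Fin m → Fin m → Set
CycAdj m i j =
  suc (toℕ i) ≡ toℕ j ⊎ suc (toℕ j) ≡ toℕ i ⊎
  (suc (toℕ i) ≡ m × toℕ j ≡ 0) ⊎ (suc (toℕ j) ≡ m × toℕ i ≡ 0)

InducedCycle : ∀ {n} → (Fin n → Fin n → Set) → (m : ℕ) → Set
InducedCycle {n} E m = Σ (Fin m → Fin n) λ c →
  Injective _≡_ _≡_ c × ((i j : Fin m) → E (c i) (c j) ⇔ CycAdj m i j)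

Chordal : ∀ {n} → (Fin n → Fin n → Set) → Set
Chordal E = (m : ℕ) → 4 ≤ m → ¬ InducedCycle E m

module Submission where

-- Let D' be a ⟨2̄,2̄⟩ subdigraph with an arc. Each of its tails has exactly two out-neighbours, which
-- (outdegrees being at most 2) are all its out-neighbours in D; each of them has exactly one further
-- in-neighbour, and irredundance makes these two partners distinct. So on the tails the competition
-- graph has all degrees 2, and it is triangle-free because D' induces no triangle: walking along it
-- until a vertex repeats closes an induced cycle of length at least 4.
-- Conversely, on an induced cycle of length at least 4 every vertex shares one out-neighbour with each
-- of its two cycle-neighbours, and these are all its out-neighbours. The arcs leaving the cycle form a
-- ⟨2̄,2̄⟩ subdigraph; P(2,2) or any of the five triangle patterns in it would make two cycle vertices
-- compete through two heads, or three of them compete pairwise, both impossible on a chordless cycle.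

open import Defs
open import Data.Nat using (ℕ; zero; suc; _≤_; _<_; _+_; z≤n; s≤s; _<?_)
open import Data.Nat.Properties
  using ( ≤-trans; ≤-reflexive; ≤-antisym; +-suc; m≤n⇒m≤1+n; n≤0⇒n≡0; <-irrefl; 0≢1+n; ≮⇒≥
        ; <-cmp; <⇒≢; n<1+n; m≤n⇒m<n∨m≡n; n≤1+n; anyUpTo?)
open import Data.Nat.Induction using (<-rec)
open import Data.Fin using (Fin; zero; suc; toℕ; fromℕ<; fromℕ; inject₁)
open import Data.Fin.Properties
  using (any?; all?; toℕ-injective; toℕ-fromℕ<; toℕ<n; toℕ-fromℕ; toℕ-inject₁; pigeonhole)
  renaming (_≟_ to _≟ᶠ_)
open import Data.Fin.Subset using (Subset; ∣_∣; _∈_; _∪_; _-_; ⁅_⁆; inside; outside) renaming (⊥ to ∅)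
open import Data.Fin.Subset.Properties
  using (p⊆q⇒∣p∣≤∣q∣; x∈p⇒∣p-x∣<∣p∣; x∈p∧x≢y⇒x∈p-y; ∣⁅x⁆∣≡1; ∣⊥∣≡0; x∈⁅x⁆; x∈p∪q⁺)
open import Data.Bool using (Bool; true; false; _∧_)
open import Data.Bool.Properties using (∧-conicalˡ; ∧-conicalʳ) renaming (_≟_ to _≟ᵇ_)
import Data.List as List
open import Data.List using (List; length; filterᵇ)
open import Data.List.Relation.Unary.All using (All; []; _∷_; lookupAny)
open import Data.List.Relation.Unary.Any using (Any) renaming (any? to anyᴸ?)
open import Data.Vec using (Vec; []; _∷_; tabulate; lookup)
open import Data.Vec.Properties using (lookup⇒[]=; []=⇒lookup; lookup∘tabulate)
open import Data.Vec.Relation.Unary.All using ([]; _∷_)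
open import Data.Vec.Relation.Unary.AllPairs using ([]; _∷_)
open import Data.Vec.Relation.Unary.Unique.Propositional using (Unique)
open import Data.Vec.Relation.Unary.Unique.Propositional.Properties using (lookup-injective)
open import Data.Product using (Σ; ∃; ∃₂; _×_; _,_; proj₁; proj₂; map₂)
open import Data.Sum using (_⊎_; inj₁; inj₂)
open import Data.Empty using (⊥; ⊥-elim)
open import Function.Bundles using (_⇔_; mk⇔; Equivalence)
open import Function.Definitions using (Injective)
open import Function.Consequences.Propositional using (contraInjective)
open import Relation.Binary.Definitions using (tri<; tri≈; tri>)
open import Relation.Binary.PropositionalEquality
  using (_≡_; _≢_; refl; sym; trans; cong; subst; subst₂; ≢-sym)
open import Relation.Nullary using (¬_; Dec; yes; no; ¬?; does)
open import Relation.Nullary.Decidable using (_×-dec_; _⊎-dec_; from-yes; dec-true)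
open import Relation.Unary using (Pred; Decidable)

private
  variable
    m n : ℕ

-- Counting satisfiers of a boolean predicate

length-filterᵇ-tabulate : ∀ {A : Set} (p : A → Bool) (f : Fin n → A) →
  length (filterᵇ p (List.tabulate f)) ≡ ∣ tabulate (λ x → p (f x)) ∣
length-filterᵇ-tabulate {zero}  p f = refl
length-filterᵇ-tabulate {suc n} p f with p (f zero)
... | true  = cong suc (length-filterᵇ-tabulate p (λ x → f (suc x)))
... | false = length-filterᵇ-tabulate p (λ x → f (suc x))

countᵇ≡∣tabulate∣ : (p : Fin n → Bool) → countᵇ p ≡ ∣ tabulate p ∣
countᵇ≡∣tabulate∣ p = length-filterᵇ-tabulate p (λ x → x)

∈-tabulate⁺ : (p : Fin n → Bool) {x : Fin n} → p x ≡ true → x ∈ tabulate p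
∈-tabulate⁺ p {x} px = lookup⇒[]= x (tabulate p) (trans (lookup∘tabulate p x) px)

∈-tabulate⁻ : {p : Fin n → Bool} {x : Fin n} → x ∈ tabulate p → p x ≡ true
∈-tabulate⁻ {p = p} {x} x∈ = trans (sym (lookup∘tabulate p x)) ([]=⇒lookup x∈)

∣p∪q∣≤∣p∣+∣q∣ : (p q : Subset n) → ∣ p ∪ q ∣ ≤ ∣ p ∣ + ∣ q ∣
∣p∪q∣≤∣p∣+∣q∣ []              []              = z≤n
∣p∪q∣≤∣p∣+∣q∣ (inside  ∷ p) (inside  ∷ q) =
  s≤s (≤-trans (m≤n⇒m≤1+n (∣p∪q∣≤∣p∣+∣q∣ p q)) (≤-reflexive (sym (+-suc ∣ p ∣ ∣ q ∣))))
∣p∪q∣≤∣p∣+∣q∣ (inside  ∷ p) (outside ∷ q) = s≤s (∣p∪q∣≤∣p∣+∣q∣ p q)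
∣p∪q∣≤∣p∣+∣q∣ (outside ∷ p) (inside  ∷ q) =
  ≤-trans (s≤s (∣p∪q∣≤∣p∣+∣q∣ p q)) (≤-reflexive (sym (+-suc ∣ p ∣ ∣ q ∣)))
∣p∪q∣≤∣p∣+∣q∣ (outside ∷ p) (outside ∷ q) = ∣p∪q∣≤∣p∣+∣q∣ p q

countᵇ≤∣_∣ : {p : Fin n → Bool} (q : Subset n) → (∀ x → p x ≡ true → x ∈ q) → countᵇ p ≤ ∣ q ∣
countᵇ≤∣_∣ {p = p} q p⊆q = subst (_≤ ∣ q ∣) (sym (countᵇ≡∣tabulate∣ p))
  (p⊆q⇒∣p∣≤∣q∣ (λ x∈ → p⊆q _ (∈-tabulate⁻ x∈)))

countᵇ≡0 : {p : Fin n → Bool} → (∀ x → p x ≢ true) → countᵇ p ≡ 0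
countᵇ≡0 {n} {p} none =
  n≤0⇒n≡0 (subst (countᵇ p ≤_) (∣⊥∣≡0 n) (countᵇ≤∣ ∅ ∣ (λ x px → ⊥-elim (none x px))))

countᵇ≤1 : {p : Fin n → Bool} (a : Fin n) → (∀ x → p x ≡ true → x ≡ a) → countᵇ p ≤ 1
countᵇ≤1 {p = p} a only-a = subst (countᵇ p ≤_) (∣⁅x⁆∣≡1 a)
  (countᵇ≤∣ ⁅ a ⁆ ∣ (λ x px → subst (_∈ ⁅ a ⁆) (sym (only-a x px)) (x∈⁅x⁆ a)))

countᵇ≤2 : {p : Fin n → Bool} (a b : Fin n) → (∀ x → p x ≡ true → x ≡ a ⊎ x ≡ b) → countᵇ p ≤ 2
countᵇ≤2 a b a-or-b = ≤-trans (countᵇ≤∣ ⁅ a ⁆ ∪ ⁅ b ⁆ ∣ (λ x px → x∈p∪q⁺ (∈-pair (a-or-b x px))))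
  (subst₂ (λ k l → ∣ ⁅ a ⁆ ∪ ⁅ b ⁆ ∣ ≤ k + l) (∣⁅x⁆∣≡1 a) (∣⁅x⁆∣≡1 b) (∣p∪q∣≤∣p∣+∣q∣ ⁅ a ⁆ ⁅ b ⁆))
  where
  ∈-pair : ∀ {x} → x ≡ a ⊎ x ≡ b → x ∈ ⁅ a ⁆ ⊎ x ∈ ⁅ b ⁆
  ∈-pair (inj₁ refl) = inj₁ (x∈⁅x⁆ a)
  ∈-pair (inj₂ refl) = inj₂ (x∈⁅x⁆ b)

x∈p⇒0<∣p∣ : {p : Subset n} {x : Fin n} → x ∈ p → 0 < ∣ p ∣
x∈p⇒0<∣p∣ x∈p = ≤-trans (s≤s z≤n) (x∈p⇒∣p-x∣<∣p∣ x∈p)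

1≤countᵇ : {p : Fin n → Bool} {a : Fin n} → p a ≡ true → 1 ≤ countᵇ p
1≤countᵇ {p = p} pa = subst (1 ≤_) (sym (countᵇ≡∣tabulate∣ p)) (x∈p⇒0<∣p∣ (∈-tabulate⁺ p pa))

2≤countᵇ : {p : Fin n → Bool} {a b : Fin n} → a ≢ b → p a ≡ true → p b ≡ true → 2 ≤ countᵇ p
2≤countᵇ {p = p} a≢b pa pb = subst (2 ≤_) (sym (countᵇ≡∣tabulate∣ p))
  (≤-trans (s≤s (x∈p⇒0<∣p∣ (x∈p∧x≢y⇒x∈p-y (∈-tabulate⁺ p pb) (≢-sym a≢b))))
           (x∈p⇒∣p-x∣<∣p∣ (∈-tabulate⁺ p pa)))

3≤countᵇ : {p : Fin n → Bool} {a b c : Fin n} → a ≢ b → a ≢ c → b ≢ c →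
           p a ≡ true → p b ≡ true → p c ≡ true → 3 ≤ countᵇ p
3≤countᵇ {p = p} {a} {b} {c} a≢b a≢c b≢c pa pb pc = subst (3 ≤_) (sym (countᵇ≡∣tabulate∣ p))
  (≤-trans (s≤s (≤-trans (s≤s (x∈p⇒0<∣p∣ c∈S-a-b)) (x∈p⇒∣p-x∣<∣p∣ b∈S-a)))
           (x∈p⇒∣p-x∣<∣p∣ (∈-tabulate⁺ p pa)))
  where
  b∈S-a : b ∈ tabulate p - a
  b∈S-a = x∈p∧x≢y⇒x∈p-y (∈-tabulate⁺ p pb) (≢-sym a≢b)
  c∈S-a-b : c ∈ tabulate p - a - b
  c∈S-a-b = x∈p∧x≢y⇒x∈p-y (x∈p∧x≢y⇒x∈p-y (∈-tabulate⁺ p pc) (≢-sym a≢c)) (≢-sym b≢c)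

countᵇ≤2⇒≡⊎≡ : {p : Fin n → Bool} {a b x : Fin n} → countᵇ p ≤ 2 → a ≢ b →
               p a ≡ true → p b ≡ true → p x ≡ true → x ≡ a ⊎ x ≡ b
countᵇ≤2⇒≡⊎≡ {a = a} {b} {x} ≤2 a≢b pa pb px with x ≟ᶠ a | x ≟ᶠ b
... | yes x≡a | _       = inj₁ x≡a
... | no _    | yes x≡b = inj₂ x≡b
... | no x≢a  | no x≢b  = ⊥-elim (<-irrefl refl
  (≤-trans (3≤countᵇ a≢b (≢-sym x≢a) (≢-sym x≢b) pa pb px) ≤2))

countᵇ≡2⇒another : {p : Fin n → Bool} {a : Fin n} → countᵇ p ≡ 2 → p a ≡ true →
                   ∃ λ b → b ≢ a × p b ≡ true
countᵇ≡2⇒another {p = p} {a} ≡2 pa with any? (λ x → ¬? (x ≟ᶠ a) ×-dec (p x ≟ᵇ true))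
... | yes (b , b≢a , pb) = b , b≢a , pb
... | no none = ⊥-elim (<-irrefl refl (≤-trans (≤-reflexive (sym ≡2)) (countᵇ≤1 a only-a)))
  where
  only-a : ∀ x → p x ≡ true → x ≡ a
  only-a x px with x ≟ᶠ a
  ... | yes x≡a = x≡a
  ... | no x≢a  = ⊥-elim (none (x , x≢a , px))

countᵇ≡2⇒pair : {p : Fin n → Bool} → countᵇ p ≡ 2 → ∃₂ λ a b → a ≢ b × p a ≡ true × p b ≡ true
countᵇ≡2⇒pair {p = p} ≡2 with any? (λ x → p x ≟ᵇ true)
... | no none = ⊥-elim (0≢1+n (trans (sym (countᵇ≡0 (λ x px → none (x , px)))) ≡2))
... | yes (a , pa) with countᵇ≡2⇒another ≡2 pa
...   | b , b≢a , pb = a , b , ≢-sym b≢a , pa , pb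

-- The cycle on Fin m

CycSucc : ℕ → ℕ → ℕ → Set
CycSucc m a b = suc a ≡ b ⊎ (suc a ≡ m × b ≡ 0)

CycSucc-functional : ∀ {a b c} → CycSucc m a b → CycSucc m a c → b < m → c < m → b ≡ c
CycSucc-functional (inj₁ refl)         (inj₁ refl)         _   _   = refl
CycSucc-functional (inj₁ refl)         (inj₂ (refl , refl)) b<m _   = ⊥-elim (<-irrefl refl b<m)
CycSucc-functional (inj₂ (refl , refl)) (inj₁ refl)         _   c<m = ⊥-elim (<-irrefl refl c<m)
CycSucc-functional (inj₂ (refl , refl)) (inj₂ (_ , refl))   _   _   = refl

CycSucc-injective : ∀ {a b c} → CycSucc m a c → CycSucc m b c → a ≡ b
CycSucc-injective (inj₁ refl)         (inj₁ refl)        = refl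
CycSucc-injective (inj₁ refl)         (inj₂ (_ , ()))
CycSucc-injective (inj₂ (_ , refl))   (inj₁ ())
CycSucc-injective (inj₂ (refl , refl)) (inj₂ (refl , _)) = refl

CycSucc-no-1-cycle : ∀ {a} → 2 ≤ m → CycSucc m a a → ⊥
CycSucc-no-1-cycle _         (inj₁ ())
CycSucc-no-1-cycle (s≤s ()) (inj₂ (refl , refl))

CycSucc-no-2-cycle : ∀ {a b} → 3 ≤ m → CycSucc m a b → CycSucc m b a → ⊥
CycSucc-no-2-cycle _                (inj₁ refl)         (inj₁ ())
CycSucc-no-2-cycle (s≤s (s≤s ())) (inj₁ refl)         (inj₂ (refl , refl))
CycSucc-no-2-cycle (s≤s (s≤s ())) (inj₂ (refl , refl)) (inj₁ refl)

CycSucc-no-3-cycle : ∀ {a b c} → 4 ≤ m → CycSucc m a b → CycSucc m b c → CycSucc m c a → ⊥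
CycSucc-no-3-cycle _                      (inj₁ refl)         (inj₁ refl)         (inj₁ ())
CycSucc-no-3-cycle (s≤s (s≤s (s≤s ()))) (inj₁ refl)         (inj₁ refl)         (inj₂ (refl , refl))
CycSucc-no-3-cycle (s≤s (s≤s (s≤s ()))) (inj₁ refl)         (inj₂ (refl , refl)) (inj₁ refl)
CycSucc-no-3-cycle _                      (inj₁ refl)         (inj₂ (refl , refl)) (inj₂ (() , _))
CycSucc-no-3-cycle (s≤s (s≤s (s≤s ()))) (inj₂ (refl , refl)) (inj₁ refl)         (inj₁ refl)

sucᶜ : Fin m → Fin m
sucᶜ {suc m} i with suc (toℕ i) <? suc m
... | yes i+1<m = fromℕ< i+1<m
... | no  _     = zero

sucᶜ-spec : (i : Fin m) → CycSucc m (toℕ i) (toℕ (sucᶜ i))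
sucᶜ-spec {suc m} i with suc (toℕ i) <? suc m
... | yes i+1<m = inj₁ (sym (toℕ-fromℕ< i+1<m))
... | no  i+1≮m = inj₂ (≤-antisym (toℕ<n i) (≮⇒≥ i+1≮m) , refl)

predᶜ : Fin m → Fin m
predᶜ {suc m} zero    = fromℕ m
predᶜ {suc m} (suc i) = inject₁ i

predᶜ-spec : (i : Fin m) → CycSucc m (toℕ (predᶜ i)) (toℕ i)
predᶜ-spec {suc m} zero    = inj₂ (cong suc (toℕ-fromℕ m) , refl)
predᶜ-spec {suc m} (suc i) = inj₁ (cong suc (toℕ-inject₁ i))

CycSucc⇒≡sucᶜ : {i j : Fin m} → CycSucc m (toℕ i) (toℕ j) → j ≡ sucᶜ i
CycSucc⇒≡sucᶜ {i = i} {j} s = toℕ-injective (CycSucc-functional s (sucᶜ-spec i) (toℕ<n j) (toℕ<n (sucᶜ i)))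

sucᶜ-injective : {i j : Fin m} → sucᶜ i ≡ sucᶜ j → i ≡ j
sucᶜ-injective {m} {i} {j} eq =
  toℕ-injective (CycSucc-injective (sucᶜ-spec i)
    (subst (CycSucc m (toℕ j)) (cong toℕ (sym eq)) (sucᶜ-spec j)))

sucᶜ-predᶜ : (i : Fin m) → sucᶜ (predᶜ i) ≡ i
sucᶜ-predᶜ i = sym (CycSucc⇒≡sucᶜ (predᶜ-spec i))

sucᶜ≢id : 2 ≤ m → (i : Fin m) → sucᶜ i ≢ i
sucᶜ≢id {m} 2≤m i eq = CycSucc-no-1-cycle 2≤m (subst (CycSucc m (toℕ i)) (cong toℕ eq) (sucᶜ-spec i))

sucᶜ²≢id : 3 ≤ m → (i : Fin m) → sucᶜ (sucᶜ i) ≢ i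
sucᶜ²≢id {m} 3≤m i eq = CycSucc-no-2-cycle 3≤m (sucᶜ-spec i)
  (subst (CycSucc m (toℕ (sucᶜ i))) (cong toℕ eq) (sucᶜ-spec (sucᶜ i)))

sucᶜ³≢id : 4 ≤ m → (i : Fin m) → sucᶜ (sucᶜ (sucᶜ i)) ≢ i
sucᶜ³≢id {m} 4≤m i eq = CycSucc-no-3-cycle 4≤m (sucᶜ-spec i) (sucᶜ-spec (sucᶜ i))
  (subst (CycSucc m (toℕ (sucᶜ (sucᶜ i)))) (cong toℕ eq) (sucᶜ-spec (sucᶜ (sucᶜ i))))

predᶜ≢id : 2 ≤ m → (i : Fin m) → predᶜ i ≢ i
predᶜ≢id 2≤m i eq = sucᶜ≢id 2≤m i (trans (cong sucᶜ (sym eq)) (sucᶜ-predᶜ i))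

sucᶜ≢predᶜ : 3 ≤ m → (i : Fin m) → sucᶜ i ≢ predᶜ i
sucᶜ≢predᶜ 3≤m i eq = sucᶜ²≢id 3≤m (predᶜ i) (trans (cong sucᶜ (sucᶜ-predᶜ i)) eq)

CycAdj⇔sucᶜ : {i j : Fin m} → CycAdj m i j ⇔ (j ≡ sucᶜ i ⊎ i ≡ sucᶜ j)
CycAdj⇔sucᶜ = mk⇔ to from
  where
  to : ∀ {i j} → CycAdj m i j → j ≡ sucᶜ i ⊎ i ≡ sucᶜ j
  to (inj₁ e)               = inj₁ (CycSucc⇒≡sucᶜ (inj₁ e))
  to (inj₂ (inj₁ e))        = inj₂ (CycSucc⇒≡sucᶜ (inj₁ e))
  to (inj₂ (inj₂ (inj₁ e))) = inj₁ (CycSucc⇒≡sucᶜ (inj₂ e))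
  to (inj₂ (inj₂ (inj₂ e))) = inj₂ (CycSucc⇒≡sucᶜ (inj₂ e))
  from-succ : ∀ {i j} → CycSucc m (toℕ i) (toℕ j) → CycAdj m i j
  from-succ (inj₁ e) = inj₁ e
  from-succ (inj₂ e) = inj₂ (inj₂ (inj₁ e))
  flip : ∀ {i j} → CycAdj m i j → CycAdj m j i
  flip (inj₁ e)               = inj₂ (inj₁ e)
  flip (inj₂ (inj₁ e))        = inj₁ e
  flip (inj₂ (inj₂ (inj₁ e))) = inj₂ (inj₂ (inj₂ e))
  flip (inj₂ (inj₂ (inj₂ e))) = inj₂ (inj₂ (inj₁ e))
  from : ∀ {i j} → j ≡ sucᶜ i ⊎ i ≡ sucᶜ j → CycAdj m i j
  from {i = i} (inj₁ refl) = from-succ (sucᶜ-spec i)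
  from {j = j} (inj₂ refl) = flip (from-succ (sucᶜ-spec j))

CycAdj-sucᶜ : (i : Fin m) → CycAdj m i (sucᶜ i)
CycAdj-sucᶜ i = Equivalence.from CycAdj⇔sucᶜ (inj₁ refl)

CycAdj-predᶜ : (i : Fin m) → CycAdj m i (predᶜ i)
CycAdj-predᶜ i = Equivalence.from CycAdj⇔sucᶜ (inj₂ (sym (sucᶜ-predᶜ i)))

CycAdj-triangle-free : 4 ≤ m → {i j k : Fin m} → i ≢ j → i ≢ k → j ≢ k →
                       CycAdj m i j → CycAdj m j k → CycAdj m i k → ⊥
CycAdj-triangle-free 4≤m {i} {j} {k} i≢j i≢k j≢k ij jk ik =
  cases (Equivalence.to CycAdj⇔sucᶜ ij) (Equivalence.to CycAdj⇔sucᶜ jk) (Equivalence.to CycAdj⇔sucᶜ ik)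
  where
  cases : j ≡ sucᶜ i ⊎ i ≡ sucᶜ j → k ≡ sucᶜ j ⊎ j ≡ sucᶜ k → k ≡ sucᶜ i ⊎ i ≡ sucᶜ k → ⊥
  cases (inj₁ refl) (inj₁ refl) (inj₁ e)    = j≢k (sym e)
  cases (inj₁ refl) (inj₁ refl) (inj₂ e)    = sucᶜ³≢id 4≤m i (sym e)
  cases (inj₁ refl) (inj₂ e)    _           = i≢k (sucᶜ-injective e)
  cases (inj₂ refl) (inj₁ refl) _           = i≢k refl
  cases (inj₂ refl) (inj₂ refl) (inj₁ e)    = sucᶜ³≢id 4≤m k (sym e)
  cases (inj₂ refl) (inj₂ refl) (inj₂ e)    = i≢j e

-- Graphs whose non-isolated vertices have degree two

Least : Pred ℕ _ → ℕ → Set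
Least P m = P m × (∀ {j} → j < m → ¬ P j)

least-witness : {P : Pred ℕ _} → Decidable P → ∀ {k} → P k → ∃ (Least P)
least-witness {P} P? {k} = <-rec (λ k → P k → ∃ (Least P)) search k
  where
  search : ∀ k → (∀ {j} → j < k → P j → ∃ (Least P)) → P k → ∃ (Least P)
  search k below Pk with anyUpTo? P? k
  ... | yes (j , j<k , Pj) = below j<k Pj
  ... | no none            = k , Pk , λ {j} j<k Pj → none (j , j<k , Pj)

module DegreeTwo {n} (E : Fin n → Fin n → Set)
  (E-sym : ∀ {u v} → E u v → E v u)
  (E-irrefl : ∀ {u} → ¬ E u u)
  (another-neighbour : ∀ {u v} → E u v → ∃ λ w → w ≢ v × E u w)
  (no-three-neighbours : ∀ {u v₁ v₂ v₃} → v₁ ≢ v₂ → v₁ ≢ v₃ → v₂ ≢ v₃ →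
                         E u v₁ → E u v₂ → E u v₃ → ⊥)
  (triangle-free : ∀ {u v w} → E u v → E v w → E u w → ⊥)
  where

  Arc : Set
  Arc = Σ (Fin n) λ u → Σ (Fin n) (E u)

  step : Arc → Arc
  step (u , v , uv) = let (w , _ , vw) = another-neighbour (E-sym uv) in v , w , vw

  module Walk (start : Arc) where

    arc : ℕ → Arc
    arc zero    = start
    arc (suc k) = step (arc k)

    x : ℕ → Fin n
    x k = proj₁ (arc k)

    x-adjacent : ∀ k → E (x k) (x (suc k))
    x-adjacent k = proj₂ (proj₂ (arc k))

    x-no-backtrack : ∀ k → x (suc (suc k)) ≢ x k
    x-no-backtrack k = proj₁ (proj₂ (another-neighbour (E-sym (x-adjacent k))))

    Repeated : ℕ → Set
    Repeated k = ∃ λ a → a < k × x a ≡ x k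

    some-repeated : ∃ Repeated
    some-repeated with pigeonhole (n<1+n n) (λ i → x (toℕ i))
    ... | i , j , i<j , xi≡xj = toℕ j , toℕ i , i<j , xi≡xj

    x-injective-below : ∀ {k a b} → (∀ {j} → j < k → ¬ Repeated j) → a < k → b < k → x a ≡ x b → a ≡ b
    x-injective-below {a = a} {b} first a<k b<k eq with <-cmp a b
    ... | tri< a<b _ _ = ⊥-elim (first b<k (a , a<b , eq))
    ... | tri≈ _ a≡b _ = a≡b
    ... | tri> _ _ b<a = ⊥-elim (first a<k (b , b<a , sym eq))

    -- A repetition x a = x k with 0 < a would give x a a third neighbour x (k - 1).
    first-repetition-returns : ∀ {k} → Least Repeated k → x 0 ≡ x k
    first-repetition-returns         ((zero , _ , eq) , _) = eq
    first-repetition-returns {suc k} ((suc a , s≤s a<k , eq) , first) with m≤n⇒m<n∨m≡n a<k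
    ... | inj₂ refl = ⊥-elim (E-irrefl (subst (λ y → E y (x (suc (suc a)))) eq (x-adjacent (suc a))))
    ... | inj₁ a+1<k = ⊥-elim (no-three-neighbours
            (≢-sym (x-no-backtrack a)) xa≢xk xa+2≢xk
            (subst (λ y → E y (x a)) eq (E-sym (x-adjacent a)))
            (subst (λ y → E y (x (suc (suc a)))) eq (x-adjacent (suc a)))
            (E-sym (x-adjacent k)))
      where
      injective : ∀ {i j} → i < suc k → j < suc k → x i ≡ x j → i ≡ j
      injective = x-injective-below first
      xa≢xk : x a ≢ x k
      xa≢xk e = <⇒≢ a<k (injective (≤-trans a<k (n≤1+n k)) (n<1+n k) e)
      xa+2≢xk : x (suc (suc a)) ≢ x k
      xa+2≢xk e = x-no-backtrack (suc a)
        (trans (cong (λ i → x (suc i)) (injective (s≤s a+1<k) (n<1+n k) e)) (sym eq))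

    first-repetition-≥4 : ∀ {k} → Least Repeated k → 4 ≤ k
    first-repetition-≥4 {0} ((_ , () , _) , _)
    first-repetition-≥4 {1} least =
      ⊥-elim (E-irrefl (subst (E (x 0)) (sym (first-repetition-returns least)) (x-adjacent 0)))
    first-repetition-≥4 {2} least =
      ⊥-elim (x-no-backtrack 0 (sym (first-repetition-returns least)))
    first-repetition-≥4 {3} least = ⊥-elim (triangle-free (x-adjacent 0) (x-adjacent 1)
      (E-sym (subst (E (x 2)) (sym (first-repetition-returns least)) (x-adjacent 2))))
    first-repetition-≥4 {suc (suc (suc (suc _)))} _ = s≤s (s≤s (s≤s (s≤s z≤n)))

    module FirstRepetition {k} (least : Least Repeated k) where

      c : Fin k → Fin n
      c i = x (toℕ i)

      c-injective : ∀ {i j} → c i ≡ c j → i ≡ j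
      c-injective {i} {j} eq = toℕ-injective (x-injective-below (proj₂ least) (toℕ<n i) (toℕ<n j) eq)

      c-sucᶜ : ∀ i → c (sucᶜ i) ≡ x (suc (toℕ i))
      c-sucᶜ i with sucᶜ-spec i
      ... | inj₁ eq          = cong x (sym eq)
      ... | inj₂ (eq₁ , eq₂) =
        trans (cong x eq₂) (trans (first-repetition-returns least) (cong x (sym eq₁)))

      E-c-sucᶜ : ∀ i → E (c i) (c (sucᶜ i))
      E-c-sucᶜ i = subst (E (c i)) (sym (c-sucᶜ i)) (x-adjacent (toℕ i))

      E-c-predᶜ : ∀ i → E (c i) (c (predᶜ i))
      E-c-predᶜ i = E-sym (subst (λ j → E (c (predᶜ i)) (c j)) (sucᶜ-predᶜ i) (E-c-sucᶜ (predᶜ i)))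

      induced : InducedCycle E k
      induced = c , c-injective , λ i j → mk⇔ (to i j) (from i j)
        where
        3≤k : 3 ≤ k
        3≤k = ≤-trans (n≤1+n 3) (first-repetition-≥4 least)
        from : ∀ i j → CycAdj k i j → E (c i) (c j)
        from i j adj with Equivalence.to CycAdj⇔sucᶜ adj
        ... | inj₁ refl = E-c-sucᶜ i
        ... | inj₂ refl = E-sym (E-c-sucᶜ j)
        to : ∀ i j → E (c i) (c j) → CycAdj k i j
        to i j e with j ≟ᶠ sucᶜ i | j ≟ᶠ predᶜ i
        ... | yes refl | _        = CycAdj-sucᶜ i
        ... | no _     | yes refl = CycAdj-predᶜ i
        ... | no j≢s   | no j≢p   = ⊥-elim (no-three-neighbours
                (λ eq → sucᶜ≢predᶜ 3≤k i (c-injective eq))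
                (λ eq → j≢s (sym (c-injective eq))) (λ eq → j≢p (sym (c-injective eq)))
                (E-c-sucᶜ i) (E-c-predᶜ i) e)

  hole : ∀ {u v} → E u v → ∃ λ k → 4 ≤ k × InducedCycle E k
  hole uv = _ , first-repetition-≥4 (proj₂ first) , FirstRepetition.induced (proj₂ first)
    where
    open Walk (_ , _ , uv)
    first : ∃ (Least Repeated)
    first = least-witness (λ k → anyUpTo? (λ a → x a ≟ᶠ x k) k) (proj₂ some-repeated)

-- From a forbidden subdigraph to a hole

Covers : ∀ {k} → List (Fin k × Fin k) → Set
Covers {k} pat = (x : Fin k) → Any (λ (a , b) → x ≡ a ⊎ x ≡ b) pat

covers? : ∀ {k} (pat : List (Fin k × Fin k)) → Dec (Covers pat)
covers? pat = all? λ x → anyᴸ? (λ (a , b) → (x ≟ᶠ a) ⊎-dec (x ≟ᶠ b)) pat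

embed : ∀ {n k} {A : Digraph n} (D : Subdigraph A) {pat : List (Fin k × Fin k)} → Covers pat →
        (xs : Vec (Fin n) k) → Unique xs →
        All (λ (a , b) → arcs D (lookup xs a) (lookup xs b) ≡ true) pat → ContainsPattern D k pat
embed D covers xs distinct arcs-xs =
  lookup xs , (λ {i} {j} → lookup-injective distinct i j) , vertex , arcs-xs
  where
  vertex : ∀ x → verts D (lookup xs x) ≡ true
  vertex x with lookupAny arcs-xs (covers x)
  ... | a→b , inj₁ x≡a = subst (λ y → verts D (lookup xs y) ≡ true) (sym x≡a) (tail∈ D _ _ a→b)
  ... | a→b , inj₂ x≡b = subst (λ y → verts D (lookup xs y) ≡ true) (sym x≡b) (head∈ D _ _ a→b)

module ForbiddenSubdigraph {n} (A : Digraph n) (loopless : Loopless A) (outdeg≤2 : ∀ v → outdeg A v ≤ 2)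
  (D : Subdigraph A) (is22 : Is22bar D) (irredundant : Irredundant D) (no-triangle : ¬ InducesTriangle D)
  where

  Tail : Fin n → Set
  Tail u = outdeg (arcs D) u ≡ 2

  arc⇒≢ : ∀ {u w} → arcs D u w ≡ true → u ≢ w
  arc⇒≢ {u} u→u refl with trans (sym (arcs⊆ D u u u→u)) (loopless u)
  ... | ()

  arc⇒tail : ∀ {u w} → arcs D u w ≡ true → Tail u
  arc⇒tail {u} {w} u→w with proj₂ (is22 u (tail∈ D u w u→w))
  ... | inj₂ ≡2 = ≡2
  ... | inj₁ ≡0 = ⊥-elim (<-irrefl (sym ≡0) (1≤countᵇ {p = arcs D u} u→w))

  arc⇒indeg≡2 : ∀ {u w} → arcs D u w ≡ true → indeg (arcs D) w ≡ 2
  arc⇒indeg≡2 {u} {w} u→w with proj₁ (is22 w (head∈ D u w u→w))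
  ... | inj₂ ≡2 = ≡2
  ... | inj₁ ≡0 = ⊥-elim (<-irrefl (sym ≡0) (1≤countᵇ {p = λ v → arcs D v w} u→w))

  no-three-in-neighbours : ∀ {u₁ u₂ u₃ w} → u₁ ≢ u₂ → u₁ ≢ u₃ → u₂ ≢ u₃ →
    arcs D u₁ w ≡ true → arcs D u₂ w ≡ true → arcs D u₃ w ≡ true → ⊥
  no-three-in-neighbours u₁≢u₂ u₁≢u₃ u₂≢u₃ u₁→w u₂→w u₃→w = <-irrefl refl
    (≤-trans (3≤countᵇ u₁≢u₂ u₁≢u₃ u₂≢u₃ u₁→w u₂→w u₃→w) (≤-reflexive (arc⇒indeg≡2 u₁→w)))

  -- A tail already has two out-neighbours in D, so outdegree ≤ 2 in A forces all its arcs into D.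
  tail-arc : ∀ {u w} → Tail u → A u w ≡ true → arcs D u w ≡ true
  tail-arc {u} {w} tail u→w with countᵇ≡2⇒pair tail
  ... | w₁ , w₂ , w₁≢w₂ , u→w₁ , u→w₂ with
        countᵇ≤2⇒≡⊎≡ (outdeg≤2 u) w₁≢w₂ (arcs⊆ D u w₁ u→w₁) (arcs⊆ D u w₂ u→w₂) u→w
  ... | inj₁ refl = u→w₁
  ... | inj₂ refl = u→w₂

  H : Fin n → Fin n → Set
  H = CompEdge (arcs D)

  H-sym : ∀ {u v} → H u v → H v u
  H-sym (u≢v , w , u→w , v→w) = ≢-sym u≢v , w , v→w , u→w

  H-irrefl : ∀ {u} → ¬ H u u
  H-irrefl (u≢u , _) = u≢u refl

  H⇒tail : ∀ {u v} → H u v → Tail u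
  H⇒tail (_ , _ , u→w , _) = arc⇒tail u→w

  CompEdge⇔H : ∀ {u v} → Tail u → Tail v → CompEdge A u v ⇔ H u v
  CompEdge⇔H tu tv = mk⇔ (λ (u≢v , w , u→w , v→w) → u≢v , w , tail-arc tu u→w , tail-arc tv v→w)
                         (λ (u≢v , w , u→w , v→w) → u≢v , w , arcs⊆ D _ w u→w , arcs⊆ D _ w v→w)

  H-no-three-neighbours : ∀ {u v₁ v₂ v₃} → v₁ ≢ v₂ → v₁ ≢ v₃ → v₂ ≢ v₃ → H u v₁ → H u v₂ → H u v₃ → ⊥
  H-no-three-neighbours {u} v₁≢v₂ v₁≢v₃ v₂≢v₃
    h₁@(u≢v₁ , w₁ , u→w₁ , v₁→w₁) (u≢v₂ , w₂ , u→w₂ , v₂→w₂) (u≢v₃ , w₃ , u→w₃ , v₃→w₃)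
    with w₁ ≟ᶠ w₂ | w₁ ≟ᶠ w₃ | w₂ ≟ᶠ w₃
  ... | yes refl | _        | _        = no-three-in-neighbours u≢v₁ u≢v₂ v₁≢v₂ u→w₁ v₁→w₁ v₂→w₂
  ... | no _     | yes refl | _        = no-three-in-neighbours u≢v₁ u≢v₃ v₁≢v₃ u→w₁ v₁→w₁ v₃→w₃
  ... | no _     | no _     | yes refl = no-three-in-neighbours u≢v₂ u≢v₃ v₂≢v₃ u→w₂ v₂→w₂ v₃→w₃
  ... | no w₁≢w₂ | no w₁≢w₃ | no w₂≢w₃ = <-irrefl refl
    (≤-trans (3≤countᵇ w₁≢w₂ w₁≢w₃ w₂≢w₃ u→w₁ u→w₂ u→w₃) (≤-reflexive (H⇒tail h₁)))

  -- The two out-neighbours of a tail have distinct second in-neighbours, else D contains P(2,2).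
  tail-two-neighbours : ∀ {u} → Tail u → ∃ λ v₁ → ∃ λ v₂ → v₁ ≢ v₂ × H u v₁ × H u v₂
  tail-two-neighbours {u} tail with countᵇ≡2⇒pair tail
  ... | w₁ , w₂ , w₁≢w₂ , u→w₁ , u→w₂
    with countᵇ≡2⇒another (arc⇒indeg≡2 u→w₁) u→w₁ | countᵇ≡2⇒another (arc⇒indeg≡2 u→w₂) u→w₂
  ... | v₁ , v₁≢u , v₁→w₁ | v₂ , v₂≢u , v₂→w₂ =
    v₁ , v₂ , v₁≢v₂ , (≢-sym v₁≢u , w₁ , u→w₁ , v₁→w₁) , (≢-sym v₂≢u , w₂ , u→w₂ , v₂→w₂)
    where
    v₁≢v₂ : v₁ ≢ v₂
    v₁≢v₂ refl = irredundant (embed D (from-yes (covers? P22)) (u ∷ v₁ ∷ w₁ ∷ w₂ ∷ [])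
      ((≢-sym v₁≢u ∷ arc⇒≢ u→w₁ ∷ arc⇒≢ u→w₂ ∷ []) ∷
       (arc⇒≢ v₁→w₁ ∷ arc⇒≢ v₂→w₂ ∷ []) ∷ (w₁≢w₂ ∷ []) ∷ [] ∷ [])
      (u→w₁ ∷ u→w₂ ∷ v₁→w₁ ∷ v₂→w₂ ∷ []))

  H-another-neighbour : ∀ {u v} → H u v → ∃ λ w → w ≢ v × H u w
  H-another-neighbour {v = v} h with tail-two-neighbours (H⇒tail h)
  ... | v₁ , v₂ , v₁≢v₂ , h₁ , h₂ with v₁ ≟ᶠ v
  ... | yes refl = v₂ , ≢-sym v₁≢v₂ , h₂
  ... | no v₁≢v  = v₁ , v₁≢v , h₁

  subst-head : ∀ {u w w′} → w ≡ w′ → arcs D u w ≡ true → arcs D u w′ ≡ true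
  subst-head {u} = subst (λ w → arcs D u w ≡ true)

  record CompetitionTriangle : Set where
    field
      u₁ u₂ u₃ w₁₂ w₁₃ w₂₃ : Fin n
      u₁≢u₂ : u₁ ≢ u₂
      u₁≢u₃ : u₁ ≢ u₃
      u₂≢u₃ : u₂ ≢ u₃
      u₁→w₁₂ : arcs D u₁ w₁₂ ≡ true
      u₂→w₁₂ : arcs D u₂ w₁₂ ≡ true
      u₁→w₁₃ : arcs D u₁ w₁₃ ≡ true
      u₃→w₁₃ : arcs D u₃ w₁₃ ≡ true
      u₂→w₂₃ : arcs D u₂ w₂₃ ≡ true
      u₃→w₂₃ : arcs D u₃ w₂₃ ≡ true

    w₁₂≢w₁₃ : w₁₂ ≢ w₁₃
    w₁₂≢w₁₃ eq = no-three-in-neighbours u₁≢u₂ u₁≢u₃ u₂≢u₃ u₁→w₁₂ u₂→w₁₂ (subst-head (sym eq) u₃→w₁₃)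

    w₁₂≢w₂₃ : w₁₂ ≢ w₂₃
    w₁₂≢w₂₃ eq = no-three-in-neighbours u₁≢u₂ u₁≢u₃ u₂≢u₃ u₁→w₁₂ u₂→w₁₂ (subst-head (sym eq) u₃→w₂₃)

    w₁₃≢w₂₃ : w₁₃ ≢ w₂₃
    w₁₃≢w₂₃ eq = no-three-in-neighbours u₁≢u₂ u₁≢u₃ u₂≢u₃ u₁→w₁₃ (subst-head (sym eq) u₂→w₂₃) u₃→w₁₃

  rotate : CompetitionTriangle → CompetitionTriangle
  rotate t = record
    { u₁ = u₂ ; u₂ = u₃ ; u₃ = u₁ ; w₁₂ = w₂₃ ; w₁₃ = w₁₂ ; w₂₃ = w₁₃
    ; u₁≢u₂ = u₂≢u₃ ; u₁≢u₃ = ≢-sym u₁≢u₂ ; u₂≢u₃ = ≢-sym u₁≢u₃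
    ; u₁→w₁₂ = u₂→w₂₃ ; u₂→w₁₂ = u₃→w₂₃ ; u₁→w₁₃ = u₂→w₁₂
    ; u₃→w₁₃ = u₁→w₁₂ ; u₂→w₂₃ = u₃→w₁₃ ; u₃→w₂₃ = u₁→w₁₃ }
    where open CompetitionTriangle t

  module _ (t : CompetitionTriangle) where
    open CompetitionTriangle t

    contains-triA : w₂₃ ≢ u₁ → w₁₃ ≢ u₂ → w₁₂ ≢ u₃ → ContainsPattern D 6 triA
    contains-triA w₂₃≢u₁ w₁₃≢u₂ w₁₂≢u₃ = embed D (from-yes (covers? triA))
      (u₁ ∷ u₂ ∷ u₃ ∷ w₁₂ ∷ w₂₃ ∷ w₁₃ ∷ [])
      ((u₁≢u₂ ∷ u₁≢u₃ ∷ arc⇒≢ u₁→w₁₂ ∷ ≢-sym w₂₃≢u₁ ∷ arc⇒≢ u₁→w₁₃ ∷ []) ∷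
       (u₂≢u₃ ∷ arc⇒≢ u₂→w₁₂ ∷ arc⇒≢ u₂→w₂₃ ∷ ≢-sym w₁₃≢u₂ ∷ []) ∷
       (≢-sym w₁₂≢u₃ ∷ arc⇒≢ u₃→w₂₃ ∷ arc⇒≢ u₃→w₁₃ ∷ []) ∷
       (w₁₂≢w₂₃ ∷ w₁₂≢w₁₃ ∷ []) ∷ (≢-sym w₁₃≢w₂₃ ∷ []) ∷ [] ∷ [])
      (u₁→w₁₂ ∷ u₁→w₁₃ ∷ u₂→w₁₂ ∷ u₂→w₂₃ ∷ u₃→w₂₃ ∷ u₃→w₁₃ ∷ [])

    contains-triC : w₁₃ ≡ u₂ → w₂₃ ≢ u₁ → w₁₂ ≢ u₃ → ContainsPattern D 5 triC
    contains-triC w₁₃≡u₂ w₂₃≢u₁ w₁₂≢u₃ = embed D (from-yes (covers? triC))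
      (u₁ ∷ u₂ ∷ u₃ ∷ w₁₂ ∷ w₂₃ ∷ [])
      ((u₁≢u₂ ∷ u₁≢u₃ ∷ arc⇒≢ u₁→w₁₂ ∷ ≢-sym w₂₃≢u₁ ∷ []) ∷
       (u₂≢u₃ ∷ arc⇒≢ u₂→w₁₂ ∷ arc⇒≢ u₂→w₂₃ ∷ []) ∷
       (≢-sym w₁₂≢u₃ ∷ arc⇒≢ u₃→w₂₃ ∷ []) ∷
       (w₁₂≢w₂₃ ∷ []) ∷ [] ∷ [])
      (u₁→w₁₂ ∷ subst-head w₁₃≡u₂ u₁→w₁₃ ∷ u₂→w₁₂ ∷ u₂→w₂₃ ∷ subst-head w₁₃≡u₂ u₃→w₁₃ ∷ u₃→w₂₃ ∷ [])

    contains-triE : w₂₃ ≡ u₁ → w₁₃ ≡ u₂ → w₁₂ ≢ u₃ → ContainsPattern D 4 triE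
    contains-triE w₂₃≡u₁ w₁₃≡u₂ w₁₂≢u₃ = embed D (from-yes (covers? triE))
      (u₁ ∷ u₂ ∷ w₁₂ ∷ u₃ ∷ [])
      ((u₁≢u₂ ∷ arc⇒≢ u₁→w₁₂ ∷ u₁≢u₃ ∷ []) ∷
       (arc⇒≢ u₂→w₁₂ ∷ u₂≢u₃ ∷ []) ∷ (w₁₂≢u₃ ∷ []) ∷ [] ∷ [])
      (subst-head w₁₃≡u₂ u₁→w₁₃ ∷ subst-head w₂₃≡u₁ u₂→w₂₃ ∷ u₁→w₁₂ ∷ u₂→w₁₂ ∷
       subst-head w₂₃≡u₁ u₃→w₂₃ ∷ subst-head w₁₃≡u₂ u₃→w₁₃ ∷ [])

    contains-triD : w₂₃ ≡ u₁ → w₁₃ ≡ u₂ → w₁₂ ≡ u₃ → ContainsPattern D 3 triD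
    contains-triD w₂₃≡u₁ w₁₃≡u₂ w₁₂≡u₃ = embed D (from-yes (covers? triD))
      (u₁ ∷ u₂ ∷ u₃ ∷ [])
      ((u₁≢u₂ ∷ u₁≢u₃ ∷ []) ∷ (u₂≢u₃ ∷ []) ∷ [] ∷ [])
      (subst-head w₁₃≡u₂ u₁→w₁₃ ∷ subst-head w₁₂≡u₃ u₁→w₁₂ ∷ subst-head w₂₃≡u₁ u₂→w₂₃ ∷
       subst-head w₁₂≡u₃ u₂→w₁₂ ∷ subst-head w₂₃≡u₁ u₃→w₂₃ ∷ subst-head w₁₃≡u₂ u₃→w₁₃ ∷ [])

  -- How many heads wᵢⱼ coincide with the opposite tail decides the pattern: none (a), one (c),
  -- two (e), three (d); rotating the triangle brings each case to the canonical one.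
  competition-triangle⇒triangle : CompetitionTriangle → InducesTriangle D
  competition-triangle⇒triangle t with w₂₃ ≟ᶠ u₁ | w₁₃ ≟ᶠ u₂ | w₁₂ ≟ᶠ u₃
    where open CompetitionTriangle t
  ... | no  p | no  q | no  r = inj₁ (contains-triA t p q r)
  ... | no  p | yes q | no  r = inj₂ (inj₂ (inj₁ (contains-triC t q p r)))
  ... | no  p | no  q | yes r = inj₂ (inj₂ (inj₁ (contains-triC (rotate t) r q p)))
  ... | yes p | no  q | no  r = inj₂ (inj₂ (inj₁ (contains-triC (rotate (rotate t)) p r q)))
  ... | yes p | yes q | no  r = inj₂ (inj₂ (inj₂ (inj₂ (contains-triE t p q r))))
  ... | no  p | yes q | yes r = inj₂ (inj₂ (inj₂ (inj₂ (contains-triE (rotate t) q r p))))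
  ... | yes p | no  q | yes r = inj₂ (inj₂ (inj₂ (inj₂ (contains-triE (rotate (rotate t)) r p q))))
  ... | yes p | yes q | yes r = inj₂ (inj₂ (inj₂ (inj₁ (contains-triD t p q r))))

  H-triangle-free : ∀ {u v w} → H u v → H v w → H u w → ⊥
  H-triangle-free (u≢v , a , u→a , v→a) (v≢w , c , v→c , w→c) (u≢w , b , u→b , w→b) =
    no-triangle (competition-triangle⇒triangle (record
      { u₁≢u₂ = u≢v ; u₁≢u₃ = u≢w ; u₂≢u₃ = v≢w
      ; u₁→w₁₂ = u→a ; u₂→w₁₂ = v→a ; u₁→w₁₃ = u→b ; u₃→w₁₃ = w→b ; u₂→w₂₃ = v→c ; u₃→w₂₃ = w→c }))

  inducedCycle-H⇒CompEdge : ∀ {m} → InducedCycle H m → InducedCycle (CompEdge A) m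
  inducedCycle-H⇒CompEdge (c , c-injective , H⇔CycAdj) = c , c-injective , λ i j → mk⇔
    (λ e → Equivalence.to (H⇔CycAdj i j) (Equivalence.to (CompEdge⇔H (tail i) (tail j)) e))
    (λ a → Equivalence.from (CompEdge⇔H (tail i) (tail j)) (Equivalence.from (H⇔CycAdj i j) a))
    where
    tail : ∀ i → Tail (c i)
    tail i = H⇒tail (Equivalence.from (H⇔CycAdj i (sucᶜ i)) (CycAdj-sucᶜ i))

  hole : HasArc D → ∃ λ m → 4 ≤ m × InducedCycle (CompEdge A) m
  hole (u , _ , u→w) with tail-two-neighbours (arc⇒tail u→w)
  ... | _ , _ , _ , uv , _ = map₂ (map₂ inducedCycle-H⇒CompEdge)
    (DegreeTwo.hole H H-sym H-irrefl H-another-neighbour H-no-three-neighbours H-triangle-free uv)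

-- From a hole to a forbidden subdigraph

module InducedHole {n} (A : Digraph n) (outdeg≤2 : ∀ v → outdeg A v ≤ 2)
  {m} (4≤m : 4 ≤ m) (c : Fin m → Fin n) (c-injective : Injective _≡_ _≡_ c)
  (c-induced : ∀ i j → CompEdge A (c i) (c j) ⇔ CycAdj m i j)
  where

  3≤m : 3 ≤ m
  3≤m = ≤-trans (n≤1+n 3) 4≤m

  c-≢ : ∀ {i j} → i ≢ j → c i ≢ c j
  c-≢ = contraInjective c-injective

  common⇒adjacent : ∀ {i j w} → i ≢ j → A (c i) w ≡ true → A (c j) w ≡ true → CycAdj m i j
  common⇒adjacent {i} {j} {w} i≢j ci→w cj→w = Equivalence.to (c-induced i j) (c-≢ i≢j , w , ci→w , cj→w)

  adjacent⇒common : ∀ {i j} → CycAdj m i j → ∃ λ w → A (c i) w ≡ true × A (c j) w ≡ true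
  adjacent⇒common {i} {j} adj = proj₂ (Equivalence.from (c-induced i j) adj)

  no-three-common : ∀ {i j k w} → i ≢ j → i ≢ k → j ≢ k →
    A (c i) w ≡ true → A (c j) w ≡ true → A (c k) w ≡ true → ⊥
  no-three-common i≢j i≢k j≢k ci→w cj→w ck→w = CycAdj-triangle-free 4≤m i≢j i≢k j≢k
    (common⇒adjacent i≢j ci→w cj→w) (common⇒adjacent j≢k cj→w ck→w) (common⇒adjacent i≢k ci→w ck→w)

  common-partner-unique : ∀ {i j k w} → i ≢ j → i ≢ k →
    A (c i) w ≡ true → A (c j) w ≡ true → A (c k) w ≡ true → j ≡ k
  common-partner-unique {j = j} {k} i≢j i≢k ci→w cj→w ck→w with j ≟ᶠ k
  ... | yes j≡k = j≡k
  ... | no  j≢k = ⊥-elim (no-three-common i≢j i≢k j≢k ci→w cj→w ck→w)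

  w⁺ w⁻ : Fin m → Fin n
  w⁺ i = proj₁ (adjacent⇒common (CycAdj-sucᶜ i))
  w⁻ i = proj₁ (adjacent⇒common (CycAdj-predᶜ i))

  c→w⁺ : ∀ i → A (c i) (w⁺ i) ≡ true
  c→w⁺ i = proj₁ (proj₂ (adjacent⇒common (CycAdj-sucᶜ i)))

  c⁺→w⁺ : ∀ i → A (c (sucᶜ i)) (w⁺ i) ≡ true
  c⁺→w⁺ i = proj₂ (proj₂ (adjacent⇒common (CycAdj-sucᶜ i)))

  c→w⁻ : ∀ i → A (c i) (w⁻ i) ≡ true
  c→w⁻ i = proj₁ (proj₂ (adjacent⇒common (CycAdj-predᶜ i)))

  c⁻→w⁻ : ∀ i → A (c (predᶜ i)) (w⁻ i) ≡ true
  c⁻→w⁻ i = proj₂ (proj₂ (adjacent⇒common (CycAdj-predᶜ i)))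

  ≢sucᶜ : ∀ i → i ≢ sucᶜ i
  ≢sucᶜ i eq = sucᶜ≢id (≤-trans (n≤1+n 2) 3≤m) i (sym eq)

  ≢predᶜ : ∀ i → i ≢ predᶜ i
  ≢predᶜ i eq = predᶜ≢id (≤-trans (n≤1+n 2) 3≤m) i (sym eq)

  w⁺≢w⁻ : ∀ i → w⁺ i ≢ w⁻ i
  w⁺≢w⁻ i eq = no-three-common (≢sucᶜ i) (≢predᶜ i) (sucᶜ≢predᶜ 3≤m i)
    (c→w⁺ i) (c⁺→w⁺ i) (subst (λ w → A (c (predᶜ i)) w ≡ true) (sym eq) (c⁻→w⁻ i))

  out-neighbour : ∀ {i w} → A (c i) w ≡ true → w ≡ w⁺ i ⊎ w ≡ w⁻ i
  out-neighbour {i} = countᵇ≤2⇒≡⊎≡ (outdeg≤2 (c i)) (w⁺≢w⁻ i) (c→w⁺ i) (c→w⁻ i)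

  outdeg-c≡2 : ∀ i → outdeg A (c i) ≡ 2
  outdeg-c≡2 i = ≤-antisym (outdeg≤2 (c i)) (2≤countᵇ (w⁺≢w⁻ i) (c→w⁺ i) (c→w⁻ i))

  out-neighbour-shared : ∀ {i w} → A (c i) w ≡ true → ∃ λ j → i ≢ j × A (c j) w ≡ true
  out-neighbour-shared {i} ci→w with out-neighbour ci→w
  ... | inj₁ refl = sucᶜ i , ≢sucᶜ i , c⁺→w⁺ i
  ... | inj₂ refl = predᶜ i , ≢predᶜ i , c⁻→w⁻ i

  w⁺-and-w⁻-not-shared : ∀ {i j} → i ≢ j → A (c j) (w⁺ i) ≡ true → A (c j) (w⁻ i) ≡ true → ⊥
  w⁺-and-w⁻-not-shared {i} i≢j cj→w⁺ cj→w⁻ = sucᶜ≢predᶜ 3≤m i (trans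
    (sym (common-partner-unique i≢j (≢sucᶜ i) (c→w⁺ i) cj→w⁺ (c⁺→w⁺ i)))
    (common-partner-unique i≢j (≢predᶜ i) (c→w⁻ i) cj→w⁻ (c⁻→w⁻ i)))

  no-two-common : ∀ {i j x y} → i ≢ j → x ≢ y → A (c i) x ≡ true → A (c i) y ≡ true →
    A (c j) x ≡ true → A (c j) y ≡ true → ⊥
  no-two-common i≢j x≢y ci→x ci→y cj→x cj→y with out-neighbour ci→x | out-neighbour ci→y
  ... | inj₁ refl | inj₁ refl = x≢y refl
  ... | inj₂ refl | inj₂ refl = x≢y refl
  ... | inj₁ refl | inj₂ refl = w⁺-and-w⁻-not-shared i≢j cj→x cj→y
  ... | inj₂ refl | inj₁ refl = w⁺-and-w⁻-not-shared i≢j cj→y cj→x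

  onCycle : Fin n → Bool
  onCycle u = does (any? λ i → c i ≟ᶠ u)

  onCycle-c : ∀ i → onCycle (c i) ≡ true
  onCycle-c i = dec-true (any? λ j → c j ≟ᶠ c i) (i , refl)

  onCycle⇒c : ∀ {u} → onCycle u ≡ true → ∃ λ i → c i ≡ u
  onCycle⇒c {u} with any? (λ i → c i ≟ᶠ u)
  ... | yes found = λ _ → found
  ... | no _      = λ ()

  -- Isolated vertices have in- and outdegree 0, so D′ may keep every vertex of D.
  D′ : Subdigraph A
  D′ = record
    { verts = λ _ → true
    ; arcs  = λ u w → onCycle u ∧ A u w
    ; arcs⊆ = λ u w → ∧-conicalʳ (onCycle u) (A u w)
    ; tail∈ = λ _ _ _ → refl
    ; head∈ = λ _ _ _ → refl
    }

  c-arc : ∀ {i w} → A (c i) w ≡ true → arcs D′ (c i) w ≡ true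
  c-arc {i} {w} ci→w = subst (λ b → b ∧ A (c i) w ≡ true) (sym (onCycle-c i)) ci→w

  arc⇒cycle : ∀ {u w} → arcs D′ u w ≡ true → ∃ λ i → c i ≡ u
  arc⇒cycle {u} {w} u→w = onCycle⇒c (∧-conicalˡ (onCycle u) (A u w) u→w)

  outdeg-D′ : ∀ u → ZeroOrTwo (outdeg (arcs D′) u)
  outdeg-D′ u with onCycle u in on
  ... | false = inj₁ (countᵇ≡0 {p = λ w → false ∧ A u w} λ _ ())
  ... | true with onCycle⇒c on
  ...   | i , refl = inj₂ (outdeg-c≡2 i)

  indeg-D′ : ∀ w → ZeroOrTwo (indeg (arcs D′) w)
  indeg-D′ w with any? (λ v → arcs D′ v w ≟ᵇ true)
  ... | no none = inj₁ (countᵇ≡0 {p = λ v → arcs D′ v w} λ v v→w → none (v , v→w))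
  ... | yes (v , v→w) with arc⇒cycle v→w
  ...   | i , refl with out-neighbour-shared (arcs⊆ D′ _ _ v→w)
  ...     | j , i≢j , cj→w =
    inj₂ (≤-antisym (countᵇ≤2 (c i) (c j) in-neighbour) (2≤countᵇ (c-≢ i≢j) v→w (c-arc cj→w)))
    where
    in-neighbour : ∀ u → arcs D′ u w ≡ true → u ≡ c i ⊎ u ≡ c j
    in-neighbour u u→w with arc⇒cycle u→w
    ... | k , refl with k ≟ᶠ i
    ...   | yes refl = inj₁ refl
    ...   | no  k≢i  = inj₂ (cong c (sym (common-partner-unique i≢j (≢-sym k≢i)
                          (arcs⊆ D′ _ _ v→w) cj→w (arcs⊆ D′ _ _ u→w))))

  irredundant : Irredundant D′
  irredundant (f , f-injective , _ , f₀→f₂ ∷ f₀→f₃ ∷ f₁→f₂ ∷ f₁→f₃ ∷ [])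
    with arc⇒cycle f₀→f₂ | arc⇒cycle f₁→f₂
  ... | i , ci≡f₀ | j , cj≡f₁ = no-two-common
    (λ i≡j → contraInjective f-injective (λ ()) (trans (sym ci≡f₀) (trans (cong c i≡j) cj≡f₁)))
    (contraInjective f-injective (λ ()))
    (from-c ci≡f₀ f₀→f₂) (from-c ci≡f₀ f₀→f₃) (from-c cj≡f₁ f₁→f₂) (from-c cj≡f₁ f₁→f₃)
    where
    from-c : ∀ {i u w} → c i ≡ u → arcs D′ u w ≡ true → A (c i) w ≡ true
    from-c {w = w} refl u→w = arcs⊆ D′ _ w u→w

  competition-triangle-free : ∀ {u₁ u₂ u₃} → CompEdge (arcs D′) u₁ u₂ → CompEdge (arcs D′) u₂ u₃ →
    CompEdge (arcs D′) u₁ u₃ → ⊥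
  competition-triangle-free e₁₂@(u₁≢u₂ , _ , u₁→ , _) e₂₃@(u₂≢u₃ , _ , u₂→ , u₃→) e₁₃@(u₁≢u₃ , _)
    with arc⇒cycle u₁→ | arc⇒cycle u₂→ | arc⇒cycle u₃→
  ... | i₁ , refl | i₂ , refl | i₃ , refl = CycAdj-triangle-free 4≤m
    (λ { refl → u₁≢u₂ refl }) (λ { refl → u₁≢u₃ refl }) (λ { refl → u₂≢u₃ refl })
    (adjacent e₁₂) (adjacent e₂₃) (adjacent e₁₃)
    where
    adjacent : ∀ {i j} → CompEdge (arcs D′) (c i) (c j) → CycAdj m i j
    adjacent {i} {j} (ci≢cj , w , ci→w , cj→w) =
      Equivalence.to (c-induced i j) (ci≢cj , w , arcs⊆ D′ _ w ci→w , arcs⊆ D′ _ w cj→w)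

  competes : ∀ {k} {f : Fin k → Fin n} → Injective _≡_ _≡_ f → ∀ {a b w} → a ≢ b →
    arcs D′ (f a) (f w) ≡ true → arcs D′ (f b) (f w) ≡ true → CompEdge (arcs D′) (f a) (f b)
  competes f-injective a≢b a→w b→w = contraInjective f-injective a≢b , _ , a→w , b→w

  no-triangle : ¬ InducesTriangle D′
  no-triangle (inj₁ (f , inj , _ , a03 ∷ a05 ∷ a13 ∷ a14 ∷ a24 ∷ a25 ∷ [])) =
    competition-triangle-free (competes inj (λ ()) a03 a13) (competes inj (λ ()) a14 a24)
      (competes inj (λ ()) a05 a25)
  no-triangle (inj₂ (inj₁ (f , inj , _ , a03 ∷ a13 ∷ a23 ∷ []))) =
    competition-triangle-free (competes inj (λ ()) a03 a13) (competes inj (λ ()) a13 a23)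
      (competes inj (λ ()) a03 a23)
  no-triangle (inj₂ (inj₂ (inj₁ (f , inj , _ , a03 ∷ a01 ∷ a13 ∷ a14 ∷ a21 ∷ a24 ∷ [])))) =
    competition-triangle-free (competes inj (λ ()) a03 a13) (competes inj (λ ()) a14 a24)
      (competes inj (λ ()) a01 a21)
  no-triangle (inj₂ (inj₂ (inj₂ (inj₁ (f , inj , _ , a01 ∷ a02 ∷ a10 ∷ a12 ∷ a20 ∷ a21 ∷ []))))) =
    competition-triangle-free (competes inj (λ ()) a02 a12) (competes inj (λ ()) a10 a20)
      (competes inj (λ ()) a01 a21)
  no-triangle (inj₂ (inj₂ (inj₂ (inj₂ (f , inj , _ , a01 ∷ a10 ∷ a02 ∷ a12 ∷ a30 ∷ a31 ∷ []))))) =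
    competition-triangle-free (competes inj (λ ()) a02 a12) (competes inj (λ ()) a10 a30)
      (competes inj (λ ()) a01 a31)

  has-arc : HasArc D′
  has-arc = c i₀ , w⁺ i₀ , c-arc (c→w⁺ i₀)
    where
    i₀ : Fin m
    i₀ = fromℕ< (≤-trans (s≤s z≤n) 4≤m)

  forbidden : Σ (Subdigraph A) λ D → Is22bar D × Irredundant D × ¬ InducesTriangle D × HasArc D
  forbidden = D′ , (λ v _ → indeg-D′ v , outdeg-D′ v) , irredundant , no-triangle , has-arc

theorem2p11 : (i n : ℕ) → 1 ≤ i → (A : Digraph n) → IJDigraph i 2 A →
    Chordal (CompEdge A) ⇔
      (¬ Σ (Subdigraph A) λ D' →
          Is22bar D' × Irredundant D' × ¬ InducesTriangle D' × HasArc D')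
theorem2p11 _ _ _ A (loopless , degrees) = mk⇔
  (λ { chordal (D , is22 , irredundant , no-triangle , has-arc) →
       let (m , 4≤m , cycle) =
             ForbiddenSubdigraph.hole A loopless outdeg≤2 D is22 irredundant no-triangle has-arc
       in chordal m 4≤m cycle })
  (λ { no-forbidden m 4≤m (c , c-injective , hole) →
       no-forbidden (InducedHole.forbidden A outdeg≤2 4≤m c c-injective hole) })
  where
  outdeg≤2 : ∀ v → outdeg A v ≤ 2
  outdeg≤2 v = proj₂ (degrees v)
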